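{- Let $n\geq 2$ be an integer and $p\geq 3$ an odd integer. For every integer $k$, $s_k(n)$ is coprime to $s_{(p-1)/2}(n)$ if and only if $(p-1)/2-k$ is coprime to $p$.
   Context: For an integer $n$, the sequence $(s_k(n))_{k\in\mathbb{Z}}$ is defined by $s_0(n)=1$, $s_1(n)=n+1$ and $s_{k+2}(n)=n\,s_{k+1}(n)-s_k(n)$ for all $k\in\mathbb{Z}$. -}

module Defs where

open import Data.Nat as ℕ using (ℕ; zero; suc)
open import Data.Integer as ℤ using (ℤ; +_; -[1+_]; _+_; _-_; _*_)
open import Data.Product using (_×_; _,_; proj₁)

sFwd : ℤ → ℕ → ℤ × ℤ
sFwd n zero = (+ 1 , n + + 1)
sFwd n (suc k) with sFwd n k
... | (a , b) = (b , n * b - a)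

-- Backward: (s_{-k}(n), s_{-k+1}(n)) for k ≥ 0, using s_k = n s_{k+1} - s_{k+2}.
sBwd : ℤ → ℕ → ℤ × ℤ
sBwd n zero = (+ 1 , n + + 1)
sBwd n (suc k) with sBwd n k
... | (a , b) = (n * a - b , a)

-- s_k(n) for k ∈ ℤ: s_0 = 1, s_1 = n + 1, s_{k+2} = n s_{k+1} - s_k.
s : ℤ → ℤ → ℤ
s (+ k)      n = proj₁ (sFwd n k)
s -[1+ k ]   n = proj₁ (sBwd n (suc k))

module Submission where

-- The index sets Z_c = { j : c ∣ s_j } are the key. Since the recurrence is linear of order two, a solution
-- with two consecutive terms divisible by c is divisible by c everywhere. Applied to j ↦ s_{a+j} + s_{a-j}
-- for a ∈ Z_c, and to j ↦ s_j + s_{-1-j}, which vanishes, this shows that Z_c is symmetric about every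
-- a ∈ Z_c and about -1/2. Composing the two reflections, Z_c is invariant under translation by 2a + 1, and
-- the translations preserving Z_c form a subgroup of ℤ.
-- If c divides s_k and s_M, where p = 2M + 1, this subgroup contains 2M + 1 and 2k + 1, hence M - k and p,
-- hence 1 when they are coprime; then c ∣ s_0 = 1. Conversely, a common divisor 2g + 1 > 1 of M - k and p
-- is a translation preserving Z_{s_g}, so s_g ≥ 2 divides both s_M and s_k.

open import Defs
open import Data.Nat as ℕ using (ℕ; _%_; _/_; _∸_)
import Data.Nat.Properties as ℕ
open import Data.Nat.Coprimality using (coprime-Bézout)
open import Data.Nat.DivMod using (m≡m%n+[m/n]*n; m*n/n≡m; m%n<n; [m+kn]%n≡m%n)
open import Data.Nat.Divisibility as ℕ using (m%n≡0⇒n∣m; n∣m⇒m%n≡0; ∣1⇒≡1)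
open import Data.Nat.GCD using (module Bézout)
open import Data.Integer as ℤ using (ℤ; +_; -[1+_]; _+_; _-_; _*_; -_; _≤_)
import Data.Integer.Properties as ℤ
open import Algebra.Properties.AbelianGroup ℤ.+-0-abelianGroup using (inverseʳ-unique)
open import Data.Integer.Coprimality using (Coprime)
open import Data.Integer.Divisibility.Signed
  using (_∣_; divides; ∣-refl; 0∣⇒≡0; m∣∣m∣; ∣ᵤ⇒∣; ∣⇒∣ᵤ;
         ∣m⇒∣-m; ∣m∣n⇒∣m+n; ∣m+n∣n⇒∣m; ∣n⇒∣m*n)
open import Data.Integer.Tactic.RingSolver using (solve-∀)
open import Data.Empty using (⊥-elim)
open import Data.Product using (Σ; _×_; _,_; proj₁)
open import Function.Base using (_∘_)
open import Function.Bundles using (_⇔_; mk⇔; Equivalence)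
open import Function.Construct.Composition using (_⇔-∘_)
open import Function.Construct.Identity using (⇔-id)
open import Function.Construct.Symmetry using (⇔-sym)
open import Relation.Binary.PropositionalEquality
  using (_≡_; _≢_; refl; sym; trans; cong; cong₂; subst; subst₂; module ≡-Reasoning)

record Recurrent (n : ℤ) (u : ℤ → ℤ) : Set where
  constructor recurrent
  field step : ∀ j → u (ℤ.suc (ℤ.suc j)) ≡ n * u (ℤ.suc j) - u j

≡-sub-sub : ∀ m {x y} → x ≡ m - y → y ≡ m - x
≡-sub-sub m {y = y} refl = lemma m y
  where
  lemma : ∀ m y → y ≡ m - (m - y)
  lemma = solve-∀

s-recurrent : ∀ n → Recurrent n (λ j → s j n)
s-recurrent n = recurrent step
  where
  step : ∀ j → s (ℤ.suc (ℤ.suc j)) n ≡ n * s (ℤ.suc j) n - s j n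
  step (+ i)                  = refl
  step -[1+ 0 ]               = ≡-sub-sub (n * s (+ 0) n) refl
  step -[1+ 1 ]               = ≡-sub-sub (n * s -[1+ 0 ] n) refl
  step -[1+ ℕ.suc (ℕ.suc i) ] = ≡-sub-sub (n * s -[1+ ℕ.suc i ] n) refl

recurrent-shift : ∀ {n u} a → Recurrent n u → Recurrent n (λ j → u (a + j))
recurrent-shift {n} {u} a (recurrent rec) = recurrent λ j →
  subst₂ (λ x y → u x ≡ n * u y - u (a + j)) (swap₂ a j) (swap₁ a j) (rec (a + j))
  where
  swap₂ : ∀ a j → + 1 + (+ 1 + (a + j)) ≡ a + (+ 1 + (+ 1 + j))
  swap₂ = solve-∀
  swap₁ : ∀ a j → + 1 + (a + j) ≡ a + (+ 1 + j)
  swap₁ = solve-∀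

recurrent-reverse : ∀ {n u} → Recurrent n u → Recurrent n (λ j → u (- j))
recurrent-reverse {n} {u} (recurrent rec) = recurrent λ j →
  ≡-sub-sub (n * u (- (ℤ.suc j)))
    (subst₂ (λ x y → u x ≡ n * u y - u (- (ℤ.suc (ℤ.suc j)))) (shift₂ j) (shift₁ j)
            (rec (- (ℤ.suc (ℤ.suc j)))))
  where
  shift₂ : ∀ j → + 1 + (+ 1 + - (+ 1 + (+ 1 + j))) ≡ - j
  shift₂ = solve-∀
  shift₁ : ∀ j → + 1 + - (+ 1 + (+ 1 + j)) ≡ - (+ 1 + j)
  shift₁ = solve-∀

recurrent-+ : ∀ {n u v} → Recurrent n u → Recurrent n v → Recurrent n (λ j → u j + v j)
recurrent-+ {n} {u} {v} (recurrent recᵤ) (recurrent recᵥ) = recurrent λ j →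
  trans (cong₂ _+_ (recᵤ j) (recᵥ j)) (lemma n (u (ℤ.suc j)) (v (ℤ.suc j)) (u j) (v j))
  where
  lemma : ∀ n a b x y → (n * a - x) + (n * b - y) ≡ n * (a + b) - (x + y)
  lemma = solve-∀

∣-recurrent : ∀ {c n u} → Recurrent n u → c ∣ u (+ 0) → c ∣ u (+ 1) → ∀ j → c ∣ u j
∣-recurrent {c} {n} {u} (recurrent rec) c∣u₀ c∣u₁ = go
  where
  ∣-step : ∀ {a x y} → x ≡ n * a - y → c ∣ a → c ∣ y → c ∣ x
  ∣-step refl c∣a c∣y = ∣m∣n⇒∣m+n (∣n⇒∣m*n n c∣a) (∣m⇒∣-m c∣y)
  forward : ∀ i → c ∣ u (+ i) × c ∣ u (+ ℕ.suc i)
  forward 0         = c∣u₀ , c∣u₁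
  forward (ℕ.suc i) with forward i
  ... | c∣a , c∣b = c∣b , ∣-step (rec (+ i)) c∣b c∣a
  backward : ∀ i → c ∣ u -[1+ i ] × c ∣ u (ℤ.suc -[1+ i ])
  backward 0         = ∣-step (≡-sub-sub (n * u (+ 0)) (rec -[1+ 0 ])) c∣u₀ c∣u₁ , c∣u₀
  backward (ℕ.suc i) with backward i
  ... | c∣a , c∣b = ∣-step (≡-sub-sub (n * u -[1+ i ]) (rec -[1+ ℕ.suc i ])) c∣a c∣b , c∣a
  go : ∀ j → c ∣ u j
  go (+ i)    = proj₁ (forward i)
  go -[1+ i ] = proj₁ (backward i)

recurrent-zero : ∀ {n u} → Recurrent n u → u (+ 0) ≡ + 0 → u (+ 1) ≡ + 0 → ∀ j → u j ≡ + 0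
recurrent-zero rec u₀≡0 u₁≡0 j = 0∣⇒≡0 (∣-recurrent rec (0∣ u₀≡0) (0∣ u₁≡0) j)
  where
  0∣ : ∀ {x} → x ≡ + 0 → + 0 ∣ x
  0∣ refl = ∣-refl

s-reflect : ∀ n j → s (- + 1 - j) n ≡ - s j n
s-reflect n j = inverseʳ-unique (s j n) _ (recurrent-zero rec (s₋₁ n) (s₋₂ n) j)
  where
  rec : Recurrent n (λ j → s j n + s (- + 1 - j) n)
  rec = recurrent-+ {u = λ j → s j n} (s-recurrent n)
          (recurrent-reverse {u = λ j → s (- + 1 + j) n} (recurrent-shift (- + 1) (s-recurrent n)))
  s₋₁ : ∀ n → + 1 + (n * + 1 - (n + + 1)) ≡ + 0
  s₋₁ = solve-∀
  s₋₂ : ∀ n → (n + + 1) + (n * (n * + 1 - (n + + 1)) - + 1) ≡ + 0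
  s₋₂ = solve-∀

recurrent-neighbours : ∀ {n u} → Recurrent n u → ∀ a → u (a + + 1) + u (a - + 1) ≡ n * u a
recurrent-neighbours {n} {u} (recurrent rec) a =
  subst₂ (λ x y → u x + u (a - + 1) ≡ n * u y) (up₂ a) (up₁ a) (sum-sub (rec (a - + 1)))
  where
  up₂ : ∀ a → + 1 + (+ 1 + (a - + 1)) ≡ a + + 1
  up₂ = solve-∀
  up₁ : ∀ a → + 1 + (a - + 1) ≡ a
  up₁ = solve-∀
  sum-sub : ∀ {x m y} → x ≡ m - y → x + y ≡ m
  sum-sub {m = m} {y} refl = lemma m y
    where
    lemma : ∀ m y → m - y + y ≡ m
    lemma = solve-∀

∣s-mirror : ∀ n {c} a j → c ∣ s a n → c ∣ s j n → c ∣ s (a + (a - j)) n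
∣s-mirror n {c} a j c∣sₐ c∣sⱼ =
  ∣m+n∣n⇒∣m (subst (λ z → c ∣ s (a + (a - j)) n + s z n) (back a j) c∣uₐ₋ⱼ) c∣sⱼ
  where
  rec : Recurrent n (λ j → s (a + j) n + s (a - j) n)
  rec = recurrent-+ {u = λ j → s (a + j) n} (recurrent-shift a (s-recurrent n))
          (recurrent-reverse {u = λ j → s (a + j) n} (recurrent-shift a (s-recurrent n)))
  c∣u₀ : c ∣ s (a + + 0) n + s (a - + 0) n
  c∣u₀ = subst (λ z → c ∣ s z n + s z n) (sym (ℤ.+-identityʳ a)) (∣m∣n⇒∣m+n c∣sₐ c∣sₐ)
  c∣u₁ : c ∣ s (a + + 1) n + s (a - + 1) n
  c∣u₁ = subst (c ∣_) (sym (recurrent-neighbours (s-recurrent n) a)) (∣n⇒∣m*n n c∣sₐ)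
  c∣uₐ₋ⱼ : c ∣ s (a + (a - j)) n + s (a - (a - j)) n
  c∣uₐ₋ⱼ = ∣-recurrent rec c∣u₀ c∣u₁ (a - j)
  back : ∀ a j → a - (a - j) ≡ j
  back = solve-∀

∣s-reflect : ∀ n {c} j → c ∣ s j n → c ∣ s (- + 1 - j) n
∣s-reflect n {c} j c∣sⱼ = subst (c ∣_) (sym (s-reflect n j)) (∣m⇒∣-m c∣sⱼ)

Bézout-unit : ∀ x y a b → 1 ℕ.+ y ℕ.* b ≡ x ℕ.* a → + 1 ≡ + x * + a - + y * + b
Bézout-unit x y a b eq = begin
  + 1                           ≡⟨ lemma (+ y * + b) ⟩
  + 1 + + y * + b - + y * + b   ≡⟨ cong (λ z → + 1 + z - + y * + b) (ℤ.pos-* y b) ⟨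
  + (1 ℕ.+ y ℕ.* b) - + y * + b ≡⟨ cong (λ z → + z - + y * + b) eq ⟩
  + (x ℕ.* a) - + y * + b       ≡⟨ cong (_- + y * + b) (ℤ.pos-* x a) ⟩
  + x * + a - + y * + b         ∎
  where
  open ≡-Reasoning
  lemma : ∀ z → + 1 ≡ + 1 + z - z
  lemma = solve-∀

record IsAdditiveSubgroup (P : ℤ → Set) : Set where
  field
    0∈ : P (+ 0)
    +-closed : ∀ {x y} → P x → P y → P (x + y)
    neg-closed : ∀ {x} → P x → P (- x)

  -closed : ∀ {x y} → P x → P y → P (x - y)
  -closed x∈ y∈ = +-closed x∈ (neg-closed y∈)

  +*-closed : ∀ i {x} → P x → P (+ i * x)
  +*-closed 0             x∈ = 0∈
  +*-closed (ℕ.suc i) {x} x∈ = subst P (sym (ℤ.suc-* (+ i) x)) (+-closed x∈ (+*-closed i x∈))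

  *-closed : ∀ i {x} → P x → P (i * x)
  *-closed (+ i)        x∈ = +*-closed i x∈
  *-closed -[1+ i ] {x} x∈ =
    subst P (ℤ.neg-distribˡ-* (+ ℕ.suc i) x) (neg-closed (+*-closed (ℕ.suc i) x∈))

  ∣-closed : ∀ {d x} → P d → d ∣ x → P x
  ∣-closed d∈ (divides q refl) = *-closed q d∈

  half-difference-closed : ∀ a b → P (+ 1 + + 2 * a) → P (+ 1 + + 2 * b) → P (b - a)
  half-difference-closed a b a∈ b∈ =
    subst P (sym (lemma a b)) (-closed (*-closed (a + + 1) (-closed b∈ a∈)) (*-closed (b - a) a∈))
    where
    lemma : ∀ a b →
            b - a ≡ (a + + 1) * ((+ 1 + + 2 * b) - (+ 1 + + 2 * a)) - (b - a) * (+ 1 + + 2 * a)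
    lemma = solve-∀

  Bézout⇒1∈ : ∀ {a b} → P (+ a) → P (+ b) → Bézout.Identity 1 a b → P (+ 1)
  Bézout⇒1∈ {a} {b} a∈ b∈ (Bézout.+- x y eq) =
    subst P (sym (Bézout-unit x y a b eq)) (-closed (+*-closed x a∈) (+*-closed y b∈))
  Bézout⇒1∈ {a} {b} a∈ b∈ (Bézout.-+ x y eq) =
    subst P (sym (Bézout-unit y x b a eq)) (-closed (+*-closed y b∈) (+*-closed x a∈))

  1∈⇒∈ : P (+ 1) → ∀ x → P x
  1∈⇒∈ 1∈P x = subst P (ℤ.*-identityʳ x) (*-closed x 1∈P)

  coprime⇒1∈ : ∀ {a b} → P a → P b → Coprime a b → P (+ 1)
  coprime⇒1∈ a∈ b∈ coprime =
    Bézout⇒1∈ (∣-closed a∈ m∣∣m∣) (∣-closed b∈ m∣∣m∣) (coprime-Bézout coprime)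

module _ (n c : ℤ) where

  Period : ℤ → Set
  Period e = ∀ j → c ∣ s j n ⇔ c ∣ s (j + e) n

  ∣s-cong : ∀ {i j} → i ≡ j → c ∣ s i n ⇔ c ∣ s j n
  ∣s-cong refl = ⇔-id _

  period-isAdditiveSubgroup : IsAdditiveSubgroup Period
  period-isAdditiveSubgroup = record
    { 0∈         = λ j → ∣s-cong (sym (ℤ.+-identityʳ j))
    ; +-closed   = λ {e} {f} pₑ pᶠ j → ∣s-cong (ℤ.+-assoc j e f) ⇔-∘ (pᶠ (j + e) ⇔-∘ pₑ j)
    ; neg-closed = λ {e} pₑ j → ⇔-sym (pₑ (j - e)) ⇔-∘ ∣s-cong (sym (cancel j e))
    }
    where
    cancel : ∀ j e → j - e + e ≡ j
    cancel = solve-∀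

  ∣s⇒period : ∀ a → c ∣ s a n → Period (+ 1 + + 2 * a)
  ∣s⇒period a c∣sₐ j = mk⇔ to from
    where
    e : ℤ
    e = + 1 + + 2 * a
    to : c ∣ s j n → c ∣ s (j + e) n
    to c∣sⱼ = subst (λ z → c ∣ s z n) (lemma a j)
      (∣s-mirror n a (- + 1 - j) c∣sₐ (∣s-reflect n j c∣sⱼ))
      where
      lemma : ∀ a j → a + (a - (- + 1 - j)) ≡ j + (+ 1 + + 2 * a)
      lemma = solve-∀
    from : c ∣ s (j + e) n → c ∣ s j n
    from c∣sⱼ₊ₑ = subst (λ z → c ∣ s z n) (lemma a j)
      (∣s-reflect n (a + (a - (j + e))) (∣s-mirror n a (j + e) c∣sₐ c∣sⱼ₊ₑ))
      where
      lemma : ∀ a j → - + 1 - (a + (a - (j + (+ 1 + + 2 * a)))) ≡ j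
      lemma = solve-∀

  ∣s-+period : ∀ a {e} → Period e → c ∣ s a n → c ∣ s (a + e) n
  ∣s-+period a p = Equivalence.to (p a)

odd≡1+2*half : ∀ {m} → m % 2 ≡ 1 → m ≡ 1 ℕ.+ 2 ℕ.* ((m ∸ 1) / 2)
odd≡1+2*half {m} m%2≡1 =
  trans m≡1+half*2 (cong (1 ℕ.+_) (trans (ℕ.*-comm (m / 2) 2) (cong (2 ℕ.*_) (sym half))))
  where
  m≡1+half*2 : m ≡ 1 ℕ.+ m / 2 ℕ.* 2
  m≡1+half*2 = trans (m≡m%n+[m/n]*n m 2) (cong (ℕ._+ m / 2 ℕ.* 2) m%2≡1)
  half : (m ∸ 1) / 2 ≡ m / 2
  half = trans (cong (λ z → (z ∸ 1) / 2) m≡1+half*2) (m*n/n≡m (m / 2) 2)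

∣odd⇒odd : ∀ {d m} → d ℕ.∣ m → m % 2 ≡ 1 → d % 2 ≡ 1
∣odd⇒odd {d} {m} d∣m m%2≡1 with d % 2 in d%2 | m%n<n d 2
... | 0                | _ = ⊥-elim (ℕ.0≢1+n (trans (sym (n∣m⇒m%n≡0 m 2 2∣m)) m%2≡1))
  where
  2∣m : 2 ℕ.∣ m
  2∣m = ℕ.∣-trans (m%n≡0⇒n∣m d 2 d%2) d∣m
... | 1                | _ = refl
... | ℕ.suc (ℕ.suc _) | ℕ.s≤s (ℕ.s≤s ())

∣1+2*⇒≡1+2* : ∀ {d} m → d ℕ.∣ 1 ℕ.+ 2 ℕ.* m → Σ ℕ λ g → d ≡ 1 ℕ.+ 2 ℕ.* g
∣1+2*⇒≡1+2* {d} m d∣ = (d ∸ 1) / 2 , odd≡1+2*half (∣odd⇒odd d∣ 1+2m-odd)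
  where
  1+2m-odd : (1 ℕ.+ 2 ℕ.* m) % 2 ≡ 1
  1+2m-odd = trans (cong (λ z → (1 ℕ.+ z) % 2) (ℕ.*-comm 2 m)) ([m+kn]%n≡m%n 1 m 2)

pos-1+2* : ∀ m → + (1 ℕ.+ 2 ℕ.* m) ≡ + 1 + + 2 * + m
pos-1+2* m = cong (_+_ (+ 1)) (ℤ.pos-* 2 m)

recurrence-increasing : ∀ {n a b} → + 2 ≤ n → + 1 ≤ a → + 1 + a ≤ b → + 1 + b ≤ n * b - a
recurrence-increasing {n} {a} {b} 2≤n 1≤a 1+a≤b = begin
  + 1 + b             ≡⟨ lemma a b ⟩
  (+ 1 + a) + b - a   ≤⟨ ℤ.+-monoˡ-≤ (- a) (ℤ.+-monoˡ-≤ b 1+a≤b) ⟩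
  b + b - a           ≡⟨ cong (_- a) (lemma₂ b) ⟩
  + 2 * b - a         ≤⟨ ℤ.+-monoˡ-≤ (- a) (ℤ.*-monoʳ-≤-nonNeg b {{ℤ.nonNegative 0≤b}} 2≤n) ⟩
  n * b - a           ∎
  where
  open ℤ.≤-Reasoning
  0≤b : + 0 ≤ b
  0≤b = ℤ.≤-trans (ℤ.+≤+ ℕ.z≤n) (ℤ.≤-trans (ℤ.i≤j⇒i≤1+j 1≤a) 1+a≤b)
  lemma : ∀ a b → + 1 + b ≡ (+ 1 + a) + b - a
  lemma = solve-∀
  lemma₂ : ∀ b → b + b ≡ + 2 * b
  lemma₂ = solve-∀

s-increasing : ∀ {n} → + 2 ≤ n → ∀ i → + 1 ≤ s (+ i) n × + 1 + s (+ i) n ≤ s (+ ℕ.suc i) n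
s-increasing 2≤n 0 = ℤ.≤-refl , ℤ.+-monoˡ-≤ (+ 1) (ℤ.≤-trans (ℤ.+≤+ (ℕ.s≤s ℕ.z≤n)) 2≤n)
s-increasing 2≤n (ℕ.suc i) with s-increasing 2≤n i
... | 1≤a , 1+a≤b = ℤ.≤-trans (ℤ.i≤j⇒i≤1+j 1≤a) 1+a≤b , recurrence-increasing 2≤n 1≤a 1+a≤b

2≤s : ∀ {n} → + 2 ≤ n → ∀ g → + 2 ≤ s (+ ℕ.suc g) n
2≤s 2≤n g with s-increasing 2≤n g
... | 1≤a , 1+a≤b = ℤ.≤-trans (ℤ.+-monoʳ-≤ (+ 1) 1≤a) 1+a≤b

2≤⇒∣∣≢1 : ∀ {x} → + 2 ≤ x → ℤ.∣ x ∣ ≢ 1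
2≤⇒∣∣≢1 (ℤ.+≤+ (ℕ.s≤s (ℕ.s≤s _))) ()

coprime-index⇒coprime-s : ∀ n a k → Coprime (a - k) (+ 1 + + 2 * a) → Coprime (s k n) (s a n)
coprime-index⇒coprime-s n a k coprime {d} (d∣sₖ , d∣sₐ) = ∣1⇒≡1 (∣⇒∣ᵤ d∣s₀)
  where
  open IsAdditiveSubgroup (period-isAdditiveSubgroup n (+ d))
  a∈ : Period n (+ d) (+ 1 + + 2 * a)
  a∈ = ∣s⇒period n (+ d) a (∣ᵤ⇒∣ d∣sₐ)
  1∈ : Period n (+ d) (+ 1)
  1∈ = coprime⇒1∈ (half-difference-closed k a (∣s⇒period n (+ d) k (∣ᵤ⇒∣ d∣sₖ)) a∈) a∈ coprime
  d∣s₀ : + d ∣ s (+ 0) n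
  d∣s₀ = subst (λ z → + d ∣ s z n) (ℤ.+-inverseʳ a)
           (∣s-+period n (+ d) a (1∈⇒∈ 1∈ (- a)) (∣ᵤ⇒∣ d∣sₐ))

coprime-s⇒coprime-index : ∀ {n} → + 2 ≤ n → ∀ m k →
                          Coprime (s k n) (s (+ m) n) → Coprime (+ m - k) (+ (1 ℕ.+ 2 ℕ.* m))
coprime-s⇒coprime-index {n} 2≤n m k coprime {i} (i∣m-k , i∣1+2m) with ∣1+2*⇒≡1+2* m i∣1+2m
... | 0       , i≡1 = i≡1
... | ℕ.suc h , i≡  = ⊥-elim (2≤⇒∣∣≢1 (2≤s 2≤n h) (coprime (∣⇒∣ᵤ Q∣sₖ , ∣⇒∣ᵤ Q∣sₘ)))
  where
  g : ℤ
  g = + ℕ.suc h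
  Q : ℤ
  Q = s g n
  open IsAdditiveSubgroup (period-isAdditiveSubgroup n Q)
  i∈ : Period n Q (+ i)
  i∈ = subst (Period n Q) (sym (trans (cong +_ i≡) (pos-1+2* (ℕ.suc h)))) (∣s⇒period n Q g ∣-refl)
  m-g∈ : Period n Q (+ m - g)
  m-g∈ = half-difference-closed g (+ m) (∣s⇒period n Q g ∣-refl)
           (subst (Period n Q) (pos-1+2* m) (∣-closed i∈ (∣ᵤ⇒∣ i∣1+2m)))
  Q∣sₘ : Q ∣ s (+ m) n
  Q∣sₘ = subst (λ z → Q ∣ s z n) (lemma g (+ m)) (∣s-+period n Q g m-g∈ ∣-refl)
    where
    lemma : ∀ g m → g + (m - g) ≡ m
    lemma = solve-∀
  m-k∈ : Period n Q (+ m - k)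
  m-k∈ = ∣-closed i∈ (∣ᵤ⇒∣ i∣m-k)
  Q∣sₖ : Q ∣ s k n
  Q∣sₖ = subst (λ z → Q ∣ s z n) (lemma (+ m) k) (∣s-+period n Q (+ m) (neg-closed m-k∈) Q∣sₘ)
    where
    lemma : ∀ m k → m - (m - k) ≡ k
    lemma = solve-∀

lemma28 : (n : ℤ) → (p : ℕ) → + 2 ℤ.≤ n → 3 ℕ.≤ p → p % 2 ≡ 1 →
          (k : ℤ) →
          Coprime (s k n) (s (+ ((p ∸ 1) / 2)) n) ⇔ Coprime (+ ((p ∸ 1) / 2) - k) (+ p)
lemma28 n p 2≤n _ p%2≡1 k = mk⇔ to from
  where
  M : ℕ
  M = (p ∸ 1) / 2
  p≡1+2M : p ≡ 1 ℕ.+ 2 ℕ.* M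
  p≡1+2M = odd≡1+2*half p%2≡1
  to : Coprime (s k n) (s (+ M) n) → Coprime (+ M - k) (+ p)
  to = subst (λ q → Coprime (+ M - k) (+ q)) (sym p≡1+2M) ∘ coprime-s⇒coprime-index 2≤n M k
  from : Coprime (+ M - k) (+ p) → Coprime (s k n) (s (+ M) n)
  from = coprime-index⇒coprime-s n (+ M) k
       ∘ subst (Coprime (+ M - k)) (trans (cong +_ p≡1+2M) (pos-1+2* M))
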